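{- Let $S$ be a Sacks tree, $\sigma=\mathrm{stem}(S)$, and let $i\neq j$ be natural numbers with $\sigma^\frown\langle i\rangle,\sigma^\frown\langle j\rangle\in S$. Let $R\subseteq A_S^{\langle i,j\rangle}$ be any relation. Then there is a Sacks tree $S'\subseteq S$ with $\mathrm{stem}(S')=\sigma$ (and $\sigma^\frown\langle i\rangle,\sigma^\frown\langle j\rangle\in S'$) such that either every $\langle\rho,\tau\rangle\in A_{S'}^{\langle i,j\rangle}$ belongs to $R$, or no $\langle\rho,\tau\rangle\in A_{S'}^{\langle i,j\rangle}$ belongs to $R$.
   Context: $\omega^{\uparrow<\omega}$ denotes the set of strictly increasing finite sequences of natural numbers. A tree is a nonempty subset of $\omega^{\uparrow<\omega}$ closed under initial segments. A Sacks tree is a tree $S$ such that every node of $S$ has an extension in $S$ with at least two immediate successors in $S$. $\mathrm{split}(S)$ is the set of nodes of $S$ with at least two immediate successors in $S$, and $\mathrm{stem}(S)$ is the shortest element of $\mathrm{split}(S)$ (the maximal node comparable with all nodes of $S$). For a Sacks tree $S$ with stem $\sigma$ and $i\neq j$ such that $\sigma^\frown\langle i\rangle,\sigma^\frown\langle j\rangle\in S$, put $A_S^{\langle i,j\rangle}=\{\langle\rho,\tau\rangle:\ \sigma^\frown\langle i\rangle\subseteq\rho\in\mathrm{split}(S),\ \sigma^\frown\langle j\rangle\subseteq\tau\in S,\ |\rho|=|\tau|\}$. -}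

module Defs where

open import Data.Nat using (ℕ; _<_; _≤_)
open import Data.List using (List; []; _∷_; _++_; [_]; length)
open import Data.List.Relation.Unary.Linked using (Linked)
open import Data.Product using (Σ; ∃; ∃-syntax; _×_; _,_)
open import Relation.Binary.PropositionalEquality using (_≡_; _≢_)

-- finite sequences of naturals are lists; strictly increasing ones form ω^{↑<ω}
Seq : Set
Seq = List ℕ

StrictlyIncreasing : Seq → Set
StrictlyIncreasing = Linked _<_

Subset : Set₁
Subset = Seq → Set

_⊑_ : Seq → Seq → Set
σ ⊑ τ = ∃[ ρ ] (σ ++ ρ ≡ τ)

_⌢_ : Seq → ℕ → Seq
σ ⌢ i = σ ++ [ i ]

_⊆_ : Subset → Subset → Set
S ⊆ T = ∀ σ → S σ → T σ

record IsTree (T : Subset) : Set where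
  field
    increasing : ∀ σ → T σ → StrictlyIncreasing σ
    nonempty   : ∃[ σ ] T σ
    downClosed : ∀ σ τ → σ ⊑ τ → T τ → T σ

Split : Subset → Subset
Split S σ = S σ × ∃[ a ] ∃[ b ] (a ≢ b × S (σ ⌢ a) × S (σ ⌢ b))

record IsSacksTree (S : Subset) : Set where
  field
    tree   : IsTree S
    perfect : ∀ σ → S σ → ∃[ τ ] (σ ⊑ τ × Split S τ)

IsStem : Subset → Seq → Set
IsStem S σ = Split S σ × (∀ τ → Split S τ → length σ ≤ length τ)

A : Subset → Seq → ℕ → ℕ → Seq → Seq → Set
A S σ i j ρ τ =
  ((σ ⌢ i) ⊑ ρ) × Split S ρ × ((σ ⌢ j) ⊑ τ) × S τ × (length ρ ≡ length τ)

{-# OPTIONS --safe #-}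
module Submission where

-- Call a pair (u, ℓ), with u above σ⌢j and ℓ above σ⌢i, avoiding if densely above ℓ there
-- are split nodes ρ none of whose partners (nodes τ above u with |τ| = |ρ|) is R-related to ρ.
-- If some pair is avoiding, then every node above ℓ together with finitely many nodes above u
-- can be matched by a split node ρ having ¬R-partners above all of them; if no pair is
-- avoiding, then classically the same holds for R above σ⌢i and σ⌢j.  Such a matching
-- property for P yields S′ by fusion: the leaves above σ⌢i are split one at a time, in a
-- queue, each new split node ρ receiving P-partners above all current leaves above σ⌢j, which
-- are then split in turn.  Every split node of S′ above σ⌢i is one of these ρ, and every node
-- of S′ above σ⌢j of length |ρ| is one of its partners.

open import Defs
open import Data.Nat using (ℕ; zero; suc; _+_; _≤_; _<_; _≤′_; ≤′-refl; ≤′-step; z≤n; s≤s; s≤s⁻¹)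
open import Data.Nat.Properties
  using (≤-trans; ≤-total; ≤-antisym; <-≤-connex; ≤⇒≤′; m≤m+n; m≤n+m; m≤n⇒m⊓n≡m; suc-injective)
open import Data.List using (List; []; _∷_; _++_; [_]; length; take; drop)
open import Data.List.Properties
  using (++-assoc; ++-identityʳ; length-take; take++drop≡id; ∷-injective; ∷ʳ-injectiveʳ)
import Data.List.NonEmpty as List⁺
open List⁺ using (List⁺; _++⁺_)
open import Data.List.Membership.Propositional using (_∈_)
open import Data.List.Membership.Propositional.Properties using (∈-++⁺ˡ; ∈-++⁺ʳ; ∈-++⁻; ∈-∃++)
open import Data.List.Relation.Unary.Any using (here; there)
open import Data.List.Relation.Unary.All as All using (All; []; _∷_)
open import Data.List.Relation.Unary.All.Properties using () renaming (++⁺ to All-++⁺)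
open import Data.List.Relation.Unary.AllPairs using (AllPairs; []; _∷_)
import Data.List.Relation.Unary.AllPairs.Properties as AllPairs
open import Data.Sum using (_⊎_; inj₁; inj₂)
import Data.Sum as Sum
open import Data.Product using (Σ; Σ-syntax; ∃-syntax; ∃₂; _×_; _,_; proj₁; proj₂)
open import Data.Empty using (⊥-elim)
open import Function using (_∘_)
open import Relation.Nullary using (¬_; yes; no)
open import Relation.Binary.PropositionalEquality
  using (_≡_; _≢_; refl; sym; trans; cong; subst; subst₂; module ≡-Reasoning)
open import Level using (0ℓ)
open import Axiom.ExcludedMiddle using (ExcludedMiddle)
open import Axiom.DoubleNegationElimination using (em⇒dne)

⊑-refl : ∀ {x} → x ⊑ x
⊑-refl {x} = [] , ++-identityʳ x

⊑-trans : ∀ {x y z} → x ⊑ y → y ⊑ z → x ⊑ z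
⊑-trans {x} (r , refl) (s , refl) = r ++ s , sym (++-assoc x r s)

⊑-⌢ : ∀ {x a} → x ⊑ (x ⌢ a)
⊑-⌢ {a = a} = [ a ] , refl

take-⊑ : ∀ n w → take n w ⊑ w
take-⊑ n w = drop n w , take++drop≡id n w

length-⌢ : ∀ x a → length (x ⌢ a) ≡ suc (length x)
length-⌢ []      a = refl
length-⌢ (b ∷ x) a = cong suc (length-⌢ x a)

⊑⇒length≤ : ∀ {x y} → x ⊑ y → length x ≤ length y
⊑⇒length≤ {[]}    _          = z≤n
⊑⇒length≤ {a ∷ x} (r , refl) = s≤s (⊑⇒length≤ {x} (r , refl))

common-prefix-≤⇒⊑ : ∀ {x y w} → x ⊑ w → y ⊑ w → length x ≤ length y → x ⊑ y
common-prefix-≤⇒⊑ {[]}    {y}     _          _        _ = y , refl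
common-prefix-≤⇒⊑ {a ∷ x} {[]}    _          _        ()
common-prefix-≤⇒⊑ {a ∷ x} {b ∷ y} (r , refl) (s , eq) (s≤s |x|≤|y|)
  with refl , eq′ ← ∷-injective eq
  with t , x++t≡y ← common-prefix-≤⇒⊑ (r , refl) (s , eq′) |x|≤|y|
  = t , cong (a ∷_) x++t≡y

common-prefix-≡⇒≡ : ∀ {x y w} → x ⊑ w → y ⊑ w → length x ≡ length y → x ≡ y
common-prefix-≡⇒≡ {[]}    {[]}    _          _        _ = refl
common-prefix-≡⇒≡ {a ∷ x} {b ∷ y} (r , refl) (s , eq) |x|≡|y|
  with refl , eq′ ← ∷-injective eq
  = cong (a ∷_) (common-prefix-≡⇒≡ (r , refl) (s , eq′) (suc-injective |x|≡|y|))

common-prefix-total : ∀ {x y w} → x ⊑ w → y ⊑ w → x ⊑ y ⊎ y ⊑ x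
common-prefix-total {x} {y} x⊑w y⊑w with ≤-total (length x) (length y)
... | inj₁ |x|≤|y| = inj₁ (common-prefix-≤⇒⊑ x⊑w y⊑w |x|≤|y|)
... | inj₂ |y|≤|x| = inj₂ (common-prefix-≤⇒⊑ y⊑w x⊑w |y|≤|x|)

⌢-⊑-unique : ∀ {x a b w} → (x ⌢ a) ⊑ w → (x ⌢ b) ⊑ w → a ≡ b
⌢-⊑-unique {x} {a} {b} p q =
  ∷ʳ-injectiveʳ x x (common-prefix-≡⇒≡ p q (trans (length-⌢ x a) (sym (length-⌢ x b))))

⌢-⊑-⌢⇒length≤ : ∀ {x a y c} → (x ⌢ a) ⊑ (y ⌢ c) → length x ≤ length y
⌢-⊑-⌢⇒length≤ {x} {a} {y} {c} p = s≤s⁻¹ (subst₂ _≤_ (length-⌢ x a) (length-⌢ y c) (⊑⇒length≤ p))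

⌢-branching-unique : ∀ {x a b y c d} → a ≢ b → (x ⌢ a) ⊑ (y ⌢ c) → (x ⌢ b) ⊑ (y ⌢ d) → x ≡ y
⌢-branching-unique {x} {a} {b} {y} a≢b p q with <-≤-connex (length x) (length y)
... | inj₁ |x|<|y| = ⊥-elim (a≢b (⌢-⊑-unique (below-y p) (below-y q)))
  where
  below-y : ∀ {e f} → (x ⌢ e) ⊑ (y ⌢ f) → (x ⌢ e) ⊑ y
  below-y {e} p = common-prefix-≤⇒⊑ p ⊑-⌢ (subst (_≤ length y) (sym (length-⌢ x e)) |x|<|y|)
... | inj₂ |y|≤|x| =
  common-prefix-≡⇒≡ (⊑-trans ⊑-⌢ p) ⊑-⌢ (≤-antisym (⌢-⊑-⌢⇒length≤ p) |y|≤|x|)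

Incomparable : Seq → Seq → Set
Incomparable x y = ¬ x ⊑ y × ¬ y ⊑ x

Incomparable-⊑ : ∀ {x y z} → Incomparable x y → x ⊑ z → Incomparable y z
Incomparable-⊑ (x⋢y , y⋢x) x⊑z =
  (λ y⊑z → Sum.[ x⋢y , y⋢x ] (common-prefix-total x⊑z y⊑z)) , (λ z⊑y → x⋢y (⊑-trans x⊑z z⊑y))

⌢-incomparable : ∀ {x a b} → a ≢ b → Incomparable (x ⌢ a) (x ⌢ b)
⌢-incomparable a≢b = (λ p → a≢b (⌢-⊑-unique p ⊑-refl)) , (λ p → a≢b (⌢-⊑-unique ⊑-refl p))

Down : List Seq → Subset
Down xs ν = ∃[ w ] (w ∈ xs × ν ⊑ w)

Branching : List Seq → Seq → Set
Branching xs π = ∃₂ λ a b → a ≢ b × (π ⌢ a) ∈ xs × (π ⌢ b) ∈ xs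

Branching-⊆ : ∀ {xs ys π} → (∀ {w} → w ∈ xs → w ∈ ys) → Branching xs π → Branching ys π
Branching-⊆ xs⊆ys (a , b , a≢b , πa∈ , πb∈) = a , b , a≢b , xs⊆ys πa∈ , xs⊆ys πb∈

Split-mono : ∀ {T U} → T ⊆ U → Split T ⊆ Split U
Split-mono T⊆U π (π∈T , a , b , a≢b , πa∈T , πb∈T) =
  T⊆U _ π∈T , a , b , a≢b , T⊆U _ πa∈T , T⊆U _ πb∈T

⊆-chain : (T : ℕ → Subset) → (∀ k → T k ⊆ T (suc k)) → ∀ {k n} → k ≤′ n → T k ⊆ T n
⊆-chain T step ≤′-refl        ν ν∈T = ν∈T
⊆-chain T step (≤′-step k≤′n) ν ν∈T = step _ ν (⊆-chain T step k≤′n ν ν∈T)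

toList-++⁺ : ∀ {A : Set} (xs : List A) ys → List⁺.toList (xs ++⁺ ys) ≡ xs ++ List⁺.toList ys
toList-++⁺ []       ys = refl
toList-++⁺ (x ∷ xs) ys = cong (x ∷_) (toList-++⁺ xs ys)

module SplitNode {T : Subset} {π : Seq} (split : Split T π) where

  a : ℕ
  a = proj₁ (proj₂ split)

  b : ℕ
  b = proj₁ (proj₂ (proj₂ split))

  a≢b : a ≢ b
  a≢b = proj₁ (proj₂ (proj₂ (proj₂ split)))

  π⌢a∈T : T (π ⌢ a)
  π⌢a∈T = proj₁ (proj₂ (proj₂ (proj₂ (proj₂ split))))

  π⌢b∈T : T (π ⌢ b)
  π⌢b∈T = proj₂ (proj₂ (proj₂ (proj₂ (proj₂ split))))

module _ {S : Subset} (sacks : IsSacksTree S) where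
  open IsSacksTree sacks
  open IsTree tree

  Cone : Seq → Subset
  Cone ν τ = S τ × ν ⊑ τ

  proper-extension : ∀ {ν} → S ν → ∃[ ν′ ] (Cone ν ν′ × length ν < length ν′)
  proper-extension {ν} ν∈S with π , ν⊑π , (_ , a , _ , _ , π⌢a∈S , _) ← perfect ν ν∈S =
    π ⌢ a , (π⌢a∈S , ⊑-trans ν⊑π ⊑-⌢) , subst (length ν <_) (sym (length-⌢ π a)) (s≤s (⊑⇒length≤ ν⊑π))

  extend-to-length : ∀ {ν} → S ν → ∀ n → ∃[ ν′ ] (Cone ν ν′ × n ≤ length ν′)
  extend-to-length ν∈S zero = _ , (ν∈S , ⊑-refl) , z≤n
  extend-to-length ν∈S (suc n)
    with ν′ , (ν′∈S , ν⊑ν′) , n≤|ν′| ← extend-to-length ν∈S n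
    with ν″ , (ν″∈S , ν′⊑ν″) , |ν′|<|ν″| ← proper-extension ν′∈S
    = ν″ , (ν″∈S , ⊑-trans ν⊑ν′ ν′⊑ν″) , ≤-trans (s≤s n≤|ν′|) |ν′|<|ν″|

  extend-to-exact-length : ∀ {ν n} → S ν → length ν ≤ n → ∃[ τ ] (Cone ν τ × length τ ≡ n)
  extend-to-exact-length {ν} {n} ν∈S |ν|≤n
    with w , (w∈S , ν⊑w) , n≤|w| ← extend-to-length ν∈S n
    = take n w , (downClosed _ w (take-⊑ n w) w∈S , ν⊑take) , |take|
    where
    |take| : length (take n w) ≡ n
    |take| = trans (length-take n w) (m≤n⇒m⊓n≡m n≤|w|)

    ν⊑take : ν ⊑ take n w
    ν⊑take = common-prefix-≤⇒⊑ ν⊑w (take-⊑ n w) (subst (length ν ≤_) (sym |take|) |ν|≤n)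

  extend-beyond : ∀ {ℓ} → S ℓ → (F : List Seq) → ∃[ ℓ′ ] (Cone ℓ ℓ′ × All (λ u → length u ≤ length ℓ′) F)
  extend-beyond ℓ∈S [] = _ , (ℓ∈S , ⊑-refl) , []
  extend-beyond ℓ∈S (u ∷ F)
    with ℓ₁ , (ℓ₁∈S , ℓ⊑ℓ₁) , |u|≤|ℓ₁| ← extend-to-length ℓ∈S (length u)
    with ℓ₂ , (ℓ₂∈S , ℓ₁⊑ℓ₂) , bounds ← extend-beyond ℓ₁∈S F
    = ℓ₂ , (ℓ₂∈S , ⊑-trans ℓ⊑ℓ₁ ℓ₁⊑ℓ₂) , ≤-trans |u|≤|ℓ₁| (⊑⇒length≤ ℓ₁⊑ℓ₂) ∷ bounds

  record Partner (P : Seq → Seq → Set) (ρ u : Seq) : Set where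
    field
      τ        : Seq
      τ∈S      : S τ
      u⊑τ      : u ⊑ τ
      length-τ : length τ ≡ length ρ
      holds    : P ρ τ

  record Matching (P : Seq → Seq → Set) (ℓ : Seq) (F : List Seq) : Set where
    field
      ρ        : Seq
      ρ-split  : Split S ρ
      ℓ⊑ρ      : ℓ ⊑ ρ
      partners : All (Partner P ρ) F

  Matchable : (Seq → Seq → Set) → Seq → Seq → Set
  Matchable P ℓ₀ u₀ = ∀ {ℓ F} → Cone ℓ₀ ℓ → All (Cone u₀) F → Matching P ℓ F

  module Sprout {P ρ u} (partner : Partner P ρ u) where
    open Partner partner

    π : Seq
    π = proj₁ (perfect τ τ∈S)

    τ⊑π : τ ⊑ π
    τ⊑π = proj₁ (proj₂ (perfect τ τ∈S))

    open SplitNode {S} {π} (proj₂ (proj₂ (perfect τ τ∈S))) public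

    u⊑π : u ⊑ π
    u⊑π = ⊑-trans u⊑τ τ⊑π

  sprouts : ∀ {P ρ F} → All (Partner P ρ) F → List Seq
  sprouts []                 = []
  sprouts (partner ∷ others) = π ⌢ a ∷ π ⌢ b ∷ sprouts others
    where open Sprout partner

  sprouts-cone : ∀ {P ρ u₀ F} → All (Cone u₀) F → (ps : All (Partner P ρ) F) → All (Cone u₀) (sprouts ps)
  sprouts-cone []                  []                 = []
  sprouts-cone ((_ , u₀⊑u) ∷ cones) (partner ∷ others) =
    (π⌢a∈T , u₀⊑π⌢) ∷ (π⌢b∈T , u₀⊑π⌢) ∷ sprouts-cone cones others
    where
    open Sprout partner

    u₀⊑π⌢ : ∀ {c} → _ ⊑ (π ⌢ c)
    u₀⊑π⌢ = ⊑-trans u₀⊑u (⊑-trans u⊑π ⊑-⌢)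

  sprouts-branching : ∀ {P ρ F u} (ps : All (Partner P ρ) F) → u ∈ F →
    ∃[ π ] (u ⊑ π × Branching (sprouts ps) π)
  sprouts-branching (partner ∷ others) (here refl) =
    π , u⊑π , a , b , a≢b , here refl , there (here refl)
    where open Sprout partner
  sprouts-branching (partner ∷ others) (there u∈F)
    with π , u⊑π , a , b , a≢b , πa∈ , πb∈ ← sprouts-branching others u∈F
    = π , u⊑π , a , b , a≢b , there (there πa∈) , there (there πb∈)

  sprouts-partner : ∀ {P ρ F w} (ps : All (Partner P ρ) F) → w ∈ sprouts ps →
    ∃[ u ] (u ∈ F × Σ[ partner ∈ Partner P ρ u ] Partner.τ partner ⊑ w)
  sprouts-partner (partner ∷ others) (here refl)         = _ , here refl , partner , ⊑-trans τ⊑π ⊑-⌢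
    where open Sprout partner
  sprouts-partner (partner ∷ others) (there (here refl)) = _ , here refl , partner , ⊑-trans τ⊑π ⊑-⌢
    where open Sprout partner
  sprouts-partner (partner ∷ others) (there (there w∈))
    with u , u∈F , p , τ⊑w ← sprouts-partner others w∈
    = u , there u∈F , p , τ⊑w

SacksSubtree : Subset → Seq → ℕ → ℕ → (Subset → Set) → Set₁
SacksSubtree S σ i j Good =
  Σ Subset λ S′ → IsSacksTree S′ × S′ ⊆ S × IsStem S′ σ × S′ (σ ⌢ i) × S′ (σ ⌢ j) × Good S′

SacksSubtree-map : ∀ {S σ i j} {G H : Subset → Set} →
  (∀ {S′} → G S′ → H S′) → SacksSubtree S σ i j G → SacksSubtree S σ i j H
SacksSubtree-map f (S′ , sacks , S′⊆S , stem , σi∈S′ , σj∈S′ , good) =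
  S′ , sacks , S′⊆S , stem , σi∈S′ , σj∈S′ , f good

module Fusion {S : Subset} (sacks : IsSacksTree S) {σ : Seq} (stem : IsStem S σ) {i j : ℕ} (i≢j : i ≢ j)
  {ℓ₀ u₀ : Seq} (ℓ₀-cone : Cone sacks (σ ⌢ i) ℓ₀) (u₀-cone : Cone sacks (σ ⌢ j) u₀)
  {P : Seq → Seq → Set} (matchable : Matchable sacks P ℓ₀ u₀) where

  open IsSacksTree sacks
  open IsTree tree

  -- The leaves of the finite approximation above ℓ₀ (a queue, whose head is split next) and
  -- above u₀.  S′ is the union of the downward closures of all stages.
  record Stage : Set where
    field
      lefts       : List⁺ Seq
      rights      : List Seq
      lefts-cone  : All (Cone sacks ℓ₀) (List⁺.toList lefts)
      rights-cone : All (Cone sacks u₀) rights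

  module Step (st : Stage) where
    open Stage st
    open Matching (matchable (All.head lefts-cone) rights-cone) public
    open SplitNode {S} {ρ} ρ-split public

    next : Stage
    next = record
      { lefts       = List⁺.tail lefts ++⁺ (ρ ⌢ a List⁺.∷ ρ ⌢ b ∷ [])
      ; rights      = sprouts sacks partners
      ; lefts-cone  = subst (All (Cone sacks ℓ₀)) (sym (toList-++⁺ (List⁺.tail lefts) _))
                        (All-++⁺ (All.tail lefts-cone) (child π⌢a∈T ∷ child π⌢b∈T ∷ []))
      ; rights-cone = sprouts-cone sacks rights-cone partners
      }
      where
      child : ∀ {c} → S (ρ ⌢ c) → Cone sacks ℓ₀ (ρ ⌢ c)
      child ρc∈S = ρc∈S , ⊑-trans (proj₂ (All.head lefts-cone)) (⊑-trans ℓ⊑ρ ⊑-⌢)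

  stage : ℕ → Stage
  stage zero = record
    { lefts       = ℓ₀ List⁺.∷ []
    ; rights      = u₀ ∷ []
    ; lefts-cone  = (proj₁ ℓ₀-cone , ⊑-refl) ∷ []
    ; rights-cone = (proj₁ u₀-cone , ⊑-refl) ∷ []
    }
  stage (suc k) = Step.next (stage k)

  module At (k : ℕ) = Step (stage k)

  active : ℕ → Seq
  active k = List⁺.head (Stage.lefts (stage k))

  queue L F Leaves : ℕ → List Seq
  queue k  = List⁺.tail (Stage.lefts (stage k))
  L k      = active k ∷ queue k
  F k      = Stage.rights (stage k)
  Leaves k = L k ++ F k

  L-cone : ∀ k {w} → w ∈ L k → Cone sacks ℓ₀ w
  L-cone k = All.lookup (Stage.lefts-cone (stage k))

  F-cone : ∀ k {w} → w ∈ F k → Cone sacks u₀ w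
  F-cone k = All.lookup (Stage.rights-cone (stage k))

  ρ : ℕ → Seq
  ρ = At.ρ

  ρ-children : ℕ → List Seq
  ρ-children k = ρ k ⌢ At.a k ∷ ρ k ⌢ At.b k ∷ []

  active⊑ρ⌢ : ∀ k {c} → active k ⊑ (ρ k ⌢ c)
  active⊑ρ⌢ k = ⊑-trans (At.ℓ⊑ρ k) ⊑-⌢

  L-suc : ∀ k → L (suc k) ≡ queue k ++ ρ-children k
  L-suc k = toList-++⁺ (queue k) _

  ∈-L-suc⁻ : ∀ k {w} → w ∈ L (suc k) → w ∈ queue k ⊎ ∃[ c ] w ≡ ρ k ⌢ c
  ∈-L-suc⁻ k w∈ with ∈-++⁻ (queue k) (subst (_ ∈_) (L-suc k) w∈)
  ... | inj₁ w∈queue             = inj₁ w∈queue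
  ... | inj₂ (here refl)         = inj₂ (_ , refl)
  ... | inj₂ (there (here refl)) = inj₂ (_ , refl)

  queue⊆L-suc : ∀ k {w} → w ∈ queue k → w ∈ L (suc k)
  queue⊆L-suc k w∈ = subst (_ ∈_) (sym (L-suc k)) (∈-++⁺ˡ w∈)

  ρ-children⊆L-suc : ∀ k {w} → w ∈ ρ-children k → w ∈ L (suc k)
  ρ-children⊆L-suc k w∈ = subst (_ ∈_) (sym (L-suc k)) (∈-++⁺ʳ (queue k) w∈)

  ρ-branching : ∀ k → Branching (L (suc k)) (ρ k)
  ρ-branching k =
    At.a k , At.b k , At.a≢b k , ρ-children⊆L-suc k (here refl) , ρ-children⊆L-suc k (there (here refl))

  L-grows : ∀ k → Down (L k) ⊆ Down (L (suc k))
  L-grows k ν (_ , here refl , ν⊑w) = _ , ρ-children⊆L-suc k (here refl) , ⊑-trans ν⊑w (active⊑ρ⌢ k)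
  L-grows k ν (w , there w∈ , ν⊑w)  = w , queue⊆L-suc k w∈ , ν⊑w

  F-grows : ∀ k → Down (F k) ⊆ Down (F (suc k))
  F-grows k ν (w , w∈ , ν⊑w)
    with π , w⊑π , a , _ , _ , πa∈ , _ ← sprouts-branching sacks (At.partners k) w∈
    = π ⌢ a , πa∈ , ⊑-trans ν⊑w (⊑-trans w⊑π ⊑-⌢)

  processed-after : ∀ ys k {w zs} → L k ≡ ys ++ w ∷ zs → ∃[ n ] w ⊑ ρ n
  processed-after []       k eq with refl , _ ← ∷-injective eq = k , At.ℓ⊑ρ k
  processed-after (y ∷ ys) k {w} {zs} eq with _ , queue≡ ← ∷-injective eq =
    processed-after ys (suc k) (begin
      L (suc k)                      ≡⟨ L-suc k ⟩
      queue k ++ ρ-children k        ≡⟨ cong (_++ ρ-children k) queue≡ ⟩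
      (ys ++ w ∷ zs) ++ ρ-children k ≡⟨ ++-assoc ys (w ∷ zs) (ρ-children k) ⟩
      ys ++ w ∷ zs ++ ρ-children k   ∎)
    where open ≡-Reasoning

  L-processed : ∀ k {w} → w ∈ L k → ∃[ n ] w ⊑ ρ n
  L-processed k w∈ with ys , _ , eq ← ∈-∃++ w∈ = processed-after ys k eq

  L-antichain : ∀ k → AllPairs Incomparable (L k)
  L-antichain zero = [] ∷ []
  L-antichain (suc k) with active∥queue ∷ queue-antichain ← L-antichain k =
    subst (AllPairs Incomparable) (sym (L-suc k))
      (AllPairs.++⁺ queue-antichain ((⌢-incomparable (At.a≢b k) ∷ []) ∷ [] ∷ [])
        (All.map (λ active∥v → Incomparable-⊑ active∥v (active⊑ρ⌢ k) ∷ Incomparable-⊑ active∥v (active⊑ρ⌢ k) ∷ [])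
                 active∥queue))

  active-below : ∀ k {x a b c w} → w ∈ queue k → (x ⌢ a) ⊑ w → (x ⌢ b) ⊑ (ρ k ⌢ c) → (x ⌢ b) ⊑ active k
  active-below k {x} {b = b} w∈ xa⊑w xb⊑ρc with <-≤-connex (length x) (length (active k))
  ... | inj₁ |x|<|active| =
    common-prefix-≤⇒⊑ xb⊑ρc (active⊑ρ⌢ k) (subst (_≤ length (active k)) (sym (length-⌢ x b)) |x|<|active|)
  ... | inj₂ |active|≤|x| with active∥queue ∷ _ ← L-antichain k =
    ⊥-elim (proj₁ (All.lookup active∥queue w∈) (⊑-trans active⊑x (⊑-trans ⊑-⌢ xa⊑w)))
    where
    active⊑x : active k ⊑ x
    active⊑x = common-prefix-≤⇒⊑ (active⊑ρ⌢ k) (⊑-trans ⊑-⌢ xb⊑ρc) |active|≤|x|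

  L-branching-point : ∀ k {x a b} → a ≢ b → Down (L k) (x ⌢ a) → Down (L k) (x ⌢ b) → ∃[ m ] x ≡ ρ m
  L-branching-point zero a≢b (_ , here refl , p) (_ , here refl , q) = ⊥-elim (a≢b (⌢-⊑-unique p q))
  L-branching-point (suc k) a≢b (w₁ , w₁∈ , p) (w₂ , w₂∈ , q) with ∈-L-suc⁻ k w₁∈ | ∈-L-suc⁻ k w₂∈
  ... | inj₁ w₁∈queue | inj₁ w₂∈queue =
    L-branching-point k a≢b (w₁ , there w₁∈queue , p) (w₂ , there w₂∈queue , q)
  ... | inj₁ w₁∈queue | inj₂ (_ , refl) =
    L-branching-point k a≢b (w₁ , there w₁∈queue , p) (_ , here refl , active-below k w₁∈queue p q)
  ... | inj₂ (_ , refl) | inj₁ w₂∈queue =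
    L-branching-point k a≢b (_ , here refl , active-below k w₂∈queue q p) (w₂ , there w₂∈queue , q)
  ... | inj₂ (_ , refl) | inj₂ (_ , refl) = k , ⌢-branching-unique a≢b p q

  F-above-partner : ∀ m {n w} → suc m ≤′ n → w ∈ F n →
    ∃[ τ ] (τ ⊑ w × length τ ≡ length (ρ m) × P (ρ m) τ)
  F-above-partner m ≤′-refl w∈ with _ , _ , partner , τ⊑w ← sprouts-partner sacks (At.partners m) w∈ =
    τ , τ⊑w , length-τ , holds
    where open Partner partner
  F-above-partner m (≤′-step {n} m<n) w∈
    with _ , u∈ , partner , τ⊑w ← sprouts-partner sacks (At.partners n) w∈
    with τ′ , τ′⊑u , |τ′| , Pτ′ ← F-above-partner m m<n u∈
    = τ′ , ⊑-trans τ′⊑u (⊑-trans (Partner.u⊑τ partner) τ⊑w) , |τ′| , Pτ′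

  S′ : Subset
  S′ ν = ∃[ k ] Down (Leaves k) ν

  S′⊆S : S′ ⊆ S
  S′⊆S ν (k , w , w∈ , ν⊑w) with ∈-++⁻ (L k) w∈
  ... | inj₁ w∈L = downClosed ν w ν⊑w (proj₁ (L-cone k w∈L))
  ... | inj₂ w∈F = downClosed ν w ν⊑w (proj₁ (F-cone k w∈F))

  S′-downClosed : ∀ ν ν′ → ν ⊑ ν′ → S′ ν′ → S′ ν
  S′-downClosed ν ν′ ν⊑ν′ (k , w , w∈ , ν′⊑w) = k , w , w∈ , ⊑-trans ν⊑ν′ ν′⊑w

  Branching⇒Split : ∀ k {π} → Branching (Leaves k) π → Split S′ π
  Branching⇒Split k (a , b , a≢b , πa∈ , πb∈) =
    (k , _ , πa∈ , ⊑-⌢) , a , b , a≢b , (k , _ , πa∈ , ⊑-refl) , (k , _ , πb∈ , ⊑-refl)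

  S′-perfect : ∀ ν → S′ ν → ∃[ π ] (ν ⊑ π × Split S′ π)
  S′-perfect ν (k , w , w∈ , ν⊑w) with ∈-++⁻ (L k) w∈
  ... | inj₁ w∈L with n , w⊑ρ ← L-processed k w∈L =
    ρ n , ⊑-trans ν⊑w w⊑ρ , Branching⇒Split (suc n) (Branching-⊆ ∈-++⁺ˡ (ρ-branching n))
  ... | inj₂ w∈F with π , w⊑π , branching ← sprouts-branching sacks (At.partners k) w∈F =
    π , ⊑-trans ν⊑w w⊑π , Branching⇒Split (suc k) (Branching-⊆ (∈-++⁺ʳ (L (suc k))) branching)

  S′-sacks : IsSacksTree S′
  S′-sacks = record
    { tree    = record
      { increasing = λ ν ν∈S′ → increasing ν (S′⊆S ν ν∈S′)
      ; nonempty   = ℓ₀ , 0 , ℓ₀ , here refl , ⊑-refl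
      ; downClosed = S′-downClosed
      }
    ; perfect = S′-perfect
    }

  σ⌢i∈S′ : S′ (σ ⌢ i)
  σ⌢i∈S′ = 0 , ℓ₀ , here refl , proj₂ ℓ₀-cone

  σ⌢j∈S′ : S′ (σ ⌢ j)
  σ⌢j∈S′ = 0 , u₀ , there (here refl) , proj₂ u₀-cone

  S′-stem : IsStem S′ σ
  S′-stem = (S′-downClosed σ _ ⊑-⌢ σ⌢i∈S′ , i , j , i≢j , σ⌢i∈S′ , σ⌢j∈S′) ,
            λ τ τ-split → proj₂ stem τ (Split-mono S′⊆S τ τ-split)

  S′-left : ∀ {ν} → (σ ⌢ i) ⊑ ν → S′ ν → ∃[ k ] Down (L k) ν
  S′-left σi⊑ν (k , w , w∈ , ν⊑w) with ∈-++⁻ (L k) w∈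
  ... | inj₁ w∈L = k , w , w∈L , ν⊑w
  ... | inj₂ w∈F = ⊥-elim (i≢j (⌢-⊑-unique (⊑-trans σi⊑ν ν⊑w)
                                           (⊑-trans (proj₂ u₀-cone) (proj₂ (F-cone k w∈F)))))

  S′-right : ∀ {ν} → (σ ⌢ j) ⊑ ν → S′ ν → ∃[ k ] Down (F k) ν
  S′-right σj⊑ν (k , w , w∈ , ν⊑w) with ∈-++⁻ (L k) w∈
  ... | inj₂ w∈F = k , w , w∈F , ν⊑w
  ... | inj₁ w∈L = ⊥-elim (i≢j (⌢-⊑-unique (⊑-trans (proj₂ ℓ₀-cone) (proj₂ (L-cone k w∈L)))
                                           (⊑-trans σj⊑ν ν⊑w)))

  S′-homogeneous : ∀ ρ′ τ → A S′ σ i j ρ′ τ → P ρ′ τ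
  S′-homogeneous ρ′ τ (σi⊑ρ′ , (_ , a , b , a≢b , ρ′a∈S′ , ρ′b∈S′) , σj⊑τ , τ∈S′ , |ρ′|≡|τ|)
    with k₁ , ρ′a-down ← S′-left (⊑-trans σi⊑ρ′ ⊑-⌢) ρ′a∈S′
    with k₂ , ρ′b-down ← S′-left (⊑-trans σi⊑ρ′ ⊑-⌢) ρ′b∈S′
    with m , refl ← L-branching-point (k₁ + k₂) a≢b
                      (⊆-chain (Down ∘ L) L-grows (≤⇒≤′ (m≤m+n k₁ k₂)) _ ρ′a-down)
                      (⊆-chain (Down ∘ L) L-grows (≤⇒≤′ (m≤n+m k₂ k₁)) _ ρ′b-down)
    with k , τ-down ← S′-right σj⊑τ τ∈S′
    with w , w∈ , τ⊑w ← ⊆-chain (Down ∘ F) F-grows (≤⇒≤′ (m≤m+n k (suc m))) _ τ-down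
    with τ′ , τ′⊑w , |τ′| , Pτ′ ← F-above-partner m (≤⇒≤′ (m≤n+m (suc m) k)) w∈
    = subst (P (ρ m)) (common-prefix-≡⇒≡ τ′⊑w τ⊑w (trans |τ′| |ρ′|≡|τ|)) Pτ′

  fusion : SacksSubtree S σ i j (λ S′ → ∀ ρ τ → A S′ σ i j ρ τ → P ρ τ)
  fusion = S′ , S′-sacks , S′⊆S , S′-stem , σ⌢i∈S′ , σ⌢j∈S′ , S′-homogeneous

module _ {S : Subset} (sacks : IsSacksTree S) (R : Seq → Seq → Set) where
  open IsSacksTree sacks

  Avoids : Seq → Seq → Set
  Avoids u ℓ = ∃[ ρ ] (Split S ρ × ℓ ⊑ ρ × (∀ τ → Cone sacks u τ → length τ ≡ length ρ → ¬ R ρ τ))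

  DenselyAvoids : Seq → Seq → Set
  DenselyAvoids u ℓ = ∀ {ℓ′} → Cone sacks ℓ ℓ′ → Avoids u ℓ′

  Avoids-⊑ : ∀ {u ℓ ℓ′} → ℓ ⊑ ℓ′ → Avoids u ℓ′ → Avoids u ℓ
  Avoids-⊑ ℓ⊑ℓ′ (ρ , ρ-split , ℓ′⊑ρ , avoid) = ρ , ρ-split , ⊑-trans ℓ⊑ℓ′ ℓ′⊑ρ , avoid

  avoiding-matchable : ∀ {ℓ₀ u₀} → DenselyAvoids u₀ ℓ₀ → Matchable sacks (λ ρ τ → ¬ R ρ τ) ℓ₀ u₀
  avoiding-matchable {ℓ₀} {u₀} avoids {ℓ} {F} (ℓ∈S , ℓ₀⊑ℓ) cones
    with ℓ′ , (ℓ′∈S , ℓ⊑ℓ′) , bounds ← extend-beyond sacks ℓ∈S F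
    with ρ , ρ-split , ℓ′⊑ρ , avoid ← avoids (ℓ′∈S , ⊑-trans ℓ₀⊑ℓ ℓ⊑ℓ′)
    = record
      { ρ        = ρ
      ; ρ-split  = ρ-split
      ; ℓ⊑ρ      = ⊑-trans ℓ⊑ℓ′ ℓ′⊑ρ
      ; partners = All.zipWith partner (cones , bounds)
      }
    where
    partner : ∀ {u} → Cone sacks u₀ u × length u ≤ length ℓ′ → Partner sacks (λ ρ τ → ¬ R ρ τ) ρ u
    partner ((u∈S , u₀⊑u) , |u|≤|ℓ′|)
      with τ , (τ∈S , u⊑τ) , |τ|≡|ρ| ← extend-to-exact-length sacks u∈S (≤-trans |u|≤|ℓ′| (⊑⇒length≤ ℓ′⊑ρ))
      = record
        { τ        = τ
        ; τ∈S      = τ∈S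
        ; u⊑τ      = u⊑τ
        ; length-τ = |τ|≡|ρ|
        ; holds    = avoid τ (τ∈S , ⊑-trans u₀⊑u u⊑τ) |τ|≡|ρ|
        }

  module _ (em : ExcludedMiddle 0ℓ) {ℓ₀ u₀ : Seq}
    (never-avoids : ∀ {u ℓ} → Cone sacks u₀ u → Cone sacks ℓ₀ ℓ → ¬ DenselyAvoids u ℓ) where

    escape : ∀ {u ℓ} → Cone sacks u₀ u → Cone sacks ℓ₀ ℓ → ∃[ ℓ′ ] (Cone sacks ℓ ℓ′ × ¬ Avoids u ℓ′)
    escape u-cone ℓ-cone =
      em⇒dne em λ no-escape → never-avoids u-cone ℓ-cone λ ℓ′-cone →
        em⇒dne em λ ¬avoids → no-escape (_ , ℓ′-cone , ¬avoids)

    escape-all : ∀ {ℓ F} → All (Cone sacks u₀) F → Cone sacks ℓ₀ ℓ →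
      ∃[ ℓ′ ] (Cone sacks ℓ ℓ′ × All (λ u → ¬ Avoids u ℓ′) F)
    escape-all []               (ℓ∈S , _) = _ , (ℓ∈S , ⊑-refl) , []
    escape-all (u-cone ∷ cones) (ℓ∈S , ℓ₀⊑ℓ)
      with ℓ₁ , (ℓ₁∈S , ℓ⊑ℓ₁) , ¬avoids₁ ← escape u-cone (ℓ∈S , ℓ₀⊑ℓ)
      with ℓ₂ , (ℓ₂∈S , ℓ₁⊑ℓ₂) , ¬avoids ← escape-all cones (ℓ₁∈S , ⊑-trans ℓ₀⊑ℓ ℓ⊑ℓ₁)
      = ℓ₂ , (ℓ₂∈S , ⊑-trans ℓ⊑ℓ₁ ℓ₁⊑ℓ₂) , (¬avoids₁ ∘ Avoids-⊑ ℓ₁⊑ℓ₂) ∷ ¬avoids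

    partner-of : ∀ {ℓ ρ u} → Split S ρ → ℓ ⊑ ρ → ¬ Avoids u ℓ → Partner sacks R ρ u
    partner-of ρ-split ℓ⊑ρ ¬avoids = em⇒dne em λ no-partner →
      ¬avoids (_ , ρ-split , ℓ⊑ρ , λ τ (τ∈S , u⊑τ) |τ| Rρτ → no-partner (record
        { τ = τ ; τ∈S = τ∈S ; u⊑τ = u⊑τ ; length-τ = |τ| ; holds = Rρτ }))

    meeting-matchable : Matchable sacks R ℓ₀ u₀
    meeting-matchable ℓ-cone cones
      with ℓ′ , (ℓ′∈S , ℓ⊑ℓ′) , ¬avoids ← escape-all cones ℓ-cone
      with ρ , ℓ′⊑ρ , ρ-split ← perfect ℓ′ ℓ′∈S
      = record
        { ρ        = ρ
        ; ρ-split  = ρ-split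
        ; ℓ⊑ρ      = ⊑-trans ℓ⊑ℓ′ ℓ′⊑ρ
        ; partners = All.map (partner-of ρ-split ℓ′⊑ρ) ¬avoids
        }

lemma1 : ExcludedMiddle 0ℓ →
    (S : Subset) → IsSacksTree S →
    (σ : Seq) → IsStem S σ →
    (i j : ℕ) → i ≢ j → S (σ ⌢ i) → S (σ ⌢ j) →
    (R : Seq → Seq → Set) → (∀ ρ τ → R ρ τ → A S σ i j ρ τ) →
    Σ Subset λ S′ →
      IsSacksTree S′ × S′ ⊆ S × IsStem S′ σ × S′ (σ ⌢ i) × S′ (σ ⌢ j) ×
      ((∀ ρ τ → A S′ σ i j ρ τ → R ρ τ) ⊎ (∀ ρ τ → A S′ σ i j ρ τ → ¬ R ρ τ))
lemma1 em S sacks σ stem i j i≢j σi∈S σj∈S R _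
  with em {∃[ u ] ∃[ ℓ ] (Cone sacks (σ ⌢ j) u × Cone sacks (σ ⌢ i) ℓ × DenselyAvoids sacks R u ℓ)}
... | yes (u , ℓ , u-cone , ℓ-cone , avoids) =
  SacksSubtree-map inj₂ (Fusion.fusion sacks stem i≢j ℓ-cone u-cone (avoiding-matchable sacks R avoids))
... | no no-avoidance =
  SacksSubtree-map inj₁ (Fusion.fusion sacks stem i≢j (σi∈S , ⊑-refl) (σj∈S , ⊑-refl)
    (meeting-matchable sacks R em λ u-cone ℓ-cone avoids →
      no-avoidance (_ , _ , u-cone , ℓ-cone , avoids)))
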